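{- For every infinite sequence $R$ in $\{\widetilde{U},\widetilde{V}\}$ and every $n\ge0$, the infinite word $\omega_{X_3(\infty)}$ has a bad cut located inside its prefix $\alpha_n\beta_n\beta_n$; more precisely, inside the first occurrence of $\beta_n$ in this prefix.
   Context: Words over $\{a,b\}$ are identified with words over $\{1,2\}$ via $a\mapsto22$, $b\mapsto11$. $\widetilde{U}(\alpha,\beta)=(\alpha\beta\beta,\alpha\beta\beta\beta)$, $\widetilde{V}(\alpha,\beta)=(\alpha\beta\beta\beta,\alpha\beta\beta\beta\beta)$. Given $R=R_1R_2\cdots$ with $R_i\in\{\widetilde{U},\widetilde{V}\}$, set $(\alpha_0,\beta_0)=(a,ab)$ and $(\alpha_n,\beta_n)=R_n(\alpha_{n-1},\beta_{n-1})$; $\alpha_n\beta_n\beta_n$ is a prefix of $\alpha_{n+1}\beta_{n+1}\beta_{n+1}$, and $\omega_{X_3(\infty)}$ is the infinite word having every $\alpha_n\beta_n\beta_n$ as a prefix. For an infinite word $w=w_1w_2\cdots$ over $\{1,2\}$ and $i\ge1$, the cut at position $i$ is $w_1\cdots w_{i-1}\,\vert\,w_iw_{i+1}\cdots$, with value $[w_i;w_{i+1},\dots]+[0;w_{i-1},\dots,w_1]$ (second term $0$ if $i=1$); it is bad if its value exceeds $3$. A cut lies inside a subword occurrence if both letters adjacent to the cut belong to that occurrence. -}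

module Defs where

open import Data.Nat using (ℕ; zero; suc; _+_; _*_; _∸_; _≤_)
open import Data.Product using (_×_; _,_; ∃; ∃-syntax)
open import Data.List using (List; []; _∷_; _++_; map; length; reverse; upTo)
open import Data.Unit using (⊤)
open import Data.Integer using (+_)
open import Data.Rational.Unnormalised using (ℚᵘ; mkℚᵘ; 0ℚᵘ; _<_)
  renaming (_+_ to _+ᵘ_)
open import Relation.Binary.PropositionalEquality using (_≡_)

data AB : Set where
  a b : AB

data Letter : Set where
  one two : Letter

val : Letter → ℕ
val one = 1
val two = 2

expandLetter : AB → List Letter
expandLetter a = two ∷ two ∷ []
expandLetter b = one ∷ one ∷ []

expand : List AB → List Letter
expand [] = []
expand (x ∷ xs) = expandLetter x ++ expand xs

data Subst : Set where
  U V : Subst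

applySubst : Subst → List AB × List AB → List AB × List AB
applySubst U (α , β) = (α ++ β ++ β , α ++ β ++ β ++ β)
applySubst V (α , β) = (α ++ β ++ β ++ β , α ++ β ++ β ++ β ++ β)

-- (α_n , β_n) for the sequence R = R_1 R_2 ⋯ , encoded as R : ℕ → Subst with R_k = R (k - 1)
αβ : (ℕ → Subst) → ℕ → List AB × List AB
αβ R zero = (a ∷ [] , a ∷ b ∷ [])
αβ R (suc n) = applySubst (R n) (αβ R n)

α : (ℕ → Subst) → ℕ → List AB
α R n = Data.Product.proj₁ (αβ R n)

β : (ℕ → Subst) → ℕ → List AB
β R n = Data.Product.proj₂ (αβ R n)

-- Infinite words over {1,2}: ω : ℕ → Letter, with ω k = w_{k+1} (0-indexed).
IsPrefix : List Letter → (ℕ → Letter) → Set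
IsPrefix [] ω = ⊤
IsPrefix (x ∷ xs) ω = (x ≡ ω 0) × IsPrefix xs (λ k → ω (suc k))

-- Finite continued fraction [x₀; x₁, …, x_m] as (numerator , denominator) via the
-- standard recursion [x₀; rest] = x₀ + 1/[rest], with the empty fraction read as 1/0 = ∞.
cfPair : List ℕ → ℕ × ℕ
cfPair [] = (1 , 0)
cfPair (x ∷ xs) with cfPair xs
... | (p , q) = (x * p + q , p)

-- p / q as an unnormalised rational (q = 0 never occurs below; junk value 0)
ratio : ℕ → ℕ → ℚᵘ
ratio p zero = 0ℚᵘ
ratio p (suc q) = mkℚᵘ (+ p) q

-- For a cut at 0-indexed position j (i.e. 1-indexed i = j + 1, cut w_1⋯w_{i-1} | w_i⋯):
-- the k-th approximation of its value:
--   [w_i; w_{i+1}, …, w_{i+k}] + [0; w_{i-1}, …, w_1].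
frontDigits : (ℕ → Letter) → ℕ → ℕ → List ℕ
frontDigits ω j k = map (λ t → val (ω (j + t))) (upTo (suc k))

backDigits : (ℕ → Letter) → ℕ → List ℕ
backDigits ω j = reverse (map (λ t → val (ω t)) (upTo j))

frontValue : (ℕ → Letter) → ℕ → ℕ → ℚᵘ
frontValue ω j k with cfPair (frontDigits ω j k)
... | (p , q) = ratio p q

-- [0; w_{i-1}, …, w_1] = 1 / [w_{i-1}; …, w_1]  (= 0 when i = 1)
backValue : (ℕ → Letter) → ℕ → ℚᵘ
backValue ω j with cfPair (backDigits ω j)
... | (s , t) = ratio t s

cutApprox : (ℕ → Letter) → ℕ → ℕ → ℚᵘ
cutApprox ω j k = frontValue ω j k +ᵘ backValue ω j

three : ℚᵘ
three = mkℚᵘ (+ 3) 0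

-- The value of the cut (the limit over k of cutApprox) exceeds 3:
-- ∃ ε > 0, ∃ N, ∀ k ≥ N, cutApprox > 3 + ε  (strict inequality of the limit).
BadCut : (ℕ → Letter) → ℕ → Set
BadCut ω j = ∃[ ε ] (0ℚᵘ < ε × ∃[ N ] ((k : ℕ) → N ≤ k → (three +ᵘ ε) < cutApprox ω j k))

-- Write α_n = a p b and β_n = a q b.  Then p and q are palindromes with p b a q = q a b p, an
-- invariant of Ũ and Ṽ, and so α_n β_n β_n = a q a b q a ⋯.  Let ŵ be the expansion over {1,2}
-- of w = q a, so ŵ = q̂ 2 2 with q̂ a palindrome.  The word reads 2 2 q̂ 2 | 2 1 1 ŵ x ⋯, and this
-- cut, which lies inside β_n, has value [2; 1, 1, ŵ, x] + [0; 2, ŵ] with x ∈ [1, 3] the value of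
-- the rest of the word.  Every letter of ŵ is doubled, so reading ŵ preserves the determinant of
-- two continuant pairs; this makes the value equal to 3 + r / (d s) with r ≥ 1, where d and s
-- are the two continuant denominators, and x ≤ 3 bounds d by a constant multiple of r that does
-- not depend on how much of the word is read.

module Submission where

open import Defs
open import Data.Nat using (ℕ; zero; suc; _+_; _*_; _∸_; _≤_; _<_; s≤s; z≤n)
open import Data.Nat.Properties
open import Data.Nat.Tactic.RingSolver using (solve; solve-∀)
open import Data.Product using (_×_; _,_; proj₁; proj₂; ∃₂; ∃-syntax)
open import Data.List using (List; []; _∷_; _++_; map; length; reverse; applyUpTo; upTo)
open import Data.List.Properties
  using (map-++; ++-assoc; ++-identityʳ; length-++; reverse-++; unfold-reverse; reverse-map; map-upTo; map-applyUpTo)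
open import Data.Integer as ℤ using (+_; +<+)
open import Data.Integer.Properties using (pos-*)
open import Data.Rational.Unnormalised as ℚᵘ using (mkℚᵘ; *<*) renaming (_+_ to _+ᵘ_)
open import Function using (_$_; _∘_)
open import Relation.Binary.PropositionalEquality

push : ℕ → ℕ × ℕ → ℕ × ℕ
push x (p , q) = (x * p + q , p)

-- the determinant of the pairs v, w is r, with the subtraction moved to the other side
record Cross (r : ℕ) (v w : ℕ × ℕ) : Set where
  constructor cross
  field identity : proj₁ v * proj₂ w ≡ proj₂ v * proj₁ w + r

push-Cross : ∀ {r v w} x → Cross r v w → Cross r (push x w) (push x v)
push-Cross {r} {p , q} {p′ , q′} x (cross h) = cross $ begin
  (x * p′ + q′) * p         ≡⟨ solve (x ∷ p ∷ q′ ∷ p′ ∷ []) ⟩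
  x * p′ * p + p * q′       ≡⟨ cong (_+_ (x * p′ * p)) h ⟩
  x * p′ * p + (q * p′ + r) ≡⟨ solve (x ∷ p ∷ q ∷ p′ ∷ r ∷ []) ⟩
  p′ * (x * p + q) + r      ∎
  where open ≡-Reasoning

cfPair-expand-Cross : ∀ w ys →
  Cross (proj₂ (cfPair (map val ys))) (cfPair (map val (expand w))) (cfPair (map val (expand w ++ ys)))
cfPair-expand-Cross []      ys = cross (+-identityʳ _)
cfPair-expand-Cross (a ∷ w) ys = push-Cross 2 (push-Cross 2 (cfPair-expand-Cross w ys))
cfPair-expand-Cross (b ∷ w) ys = push-Cross 1 (push-Cross 1 (cfPair-expand-Cross w ys))

record Dominated (c : ℕ) (v w : ℕ × ℕ) : Set where
  constructor dominated
  field
    proj₁-≤ : proj₁ v ≤ c * proj₁ w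
    proj₂-≤ : proj₂ v ≤ c * proj₂ w

push-Dominated : ∀ {c v w} x → Dominated c v w → Dominated c (push x v) (push x w)
push-Dominated {c} {p , q} {p′ , q′} x (dominated p≤ q≤) = dominated bound p≤
  where
  open ≤-Reasoning
  bound : x * p + q ≤ c * (x * p′ + q′)
  bound = begin
    x * p + q               ≤⟨ +-mono-≤ (*-monoʳ-≤ x p≤) q≤ ⟩
    x * (c * p′) + c * q′   ≡⟨ solve (x ∷ c ∷ p′ ∷ q′ ∷ []) ⟩
    c * (x * p′ + q′)       ∎

cfPair-++-Dominated : ∀ {c} xs {ys zs} → Dominated c (cfPair ys) (cfPair zs) →
  Dominated c (cfPair (xs ++ ys)) (cfPair (xs ++ zs))
cfPair-++-Dominated []       h = h
cfPair-++-Dominated (x ∷ xs) h = push-Dominated x (cfPair-++-Dominated xs h)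

val≤2 : ∀ l → val l ≤ 2
val≤2 one = s≤s z≤n
val≤2 two = s≤s (s≤s z≤n)

≤-val* : ∀ l {n} → n ≤ val l * n
≤-val* one {n} = m≤n*m n 1
≤-val* two {n} = m≤n*m n 2

cfPair-letters : ∀ L →
  0 < proj₁ (cfPair (map val L)) × proj₂ (cfPair (map val L)) ≤ proj₁ (cfPair (map val L))
cfPair-letters []      = s≤s z≤n , z≤n
cfPair-letters (l ∷ L) = <-≤-trans (proj₁ (cfPair-letters L)) grows , grows
  where
  grows : proj₁ (cfPair (map val L)) ≤ val l * proj₁ (cfPair (map val L)) + proj₂ (cfPair (map val L))
  grows = ≤-trans (≤-val* l) (m≤m+n _ _)

push-val≤3* : ∀ l {p q} → q ≤ p → val l * p + q ≤ p * 3
push-val≤3* l {p} {q} q≤p = begin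
  val l * p + q ≤⟨ +-mono-≤ (*-monoˡ-≤ p (val≤2 l)) q≤p ⟩
  2 * p + p     ≡⟨ solve (p ∷ []) ⟩
  p * 3         ∎
  where open ≤-Reasoning

cfPair-letters-≤3 : ∀ l L → let R = proj₁ (cfPair (map val L)) in
  0 < R × Dominated R (cfPair (map val (l ∷ L))) (cfPair (3 ∷ []))
cfPair-letters-≤3 l L =
  proj₁ (cfPair-letters L) ,
  dominated (push-val≤3* l (proj₂ (cfPair-letters L))) (≤-reflexive (sym (*-identityʳ _)))

cut-identity : ∀ {c t w u v} → Cross c (t , w) (u , v) →
  let front = push 2 (push 1 (push 1 (u , v))) ; back = push 2 (t , w) in
  proj₁ front * proj₁ back + proj₂ back * proj₂ front ≡ 3 * (proj₂ front * proj₁ back) + c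
cut-identity {c} {t} {w} {u} {v} (cross h) =
  cancel (trans (polynomial u v t w) (cong (λ z → 3 * ((1 * (1 * u + v) + u) * (2 * t + w)) + z) h))
  where
  cancel : ∀ {x y k} → x + k ≡ y + (k + c) → x ≡ y + c
  cancel {x} {y} {k} e = +-cancelʳ-≡ k x (y + c) (trans e (solve (y ∷ k ∷ c ∷ [])))
  -- front = (5u + 3v, 2u + v) and back = (2t + w, t), unfolded as push computes them
  polynomial : ∀ u v t w →
    (2 * (1 * (1 * u + v) + u) + (1 * u + v)) * (2 * t + w) + t * (1 * (1 * u + v) + u) + w * u
      ≡ 3 * ((1 * (1 * u + v) + u) * (2 * t + w)) + t * v
  polynomial = solve-∀

excess-cross-multiplied : ∀ {x d c} e → x ≡ 3 * d + c → d < c * suc e →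
  (3 * suc e + 1) * d < x * suc e
excess-cross-multiplied {x} {d} {c} e refl small = begin-strict
  (3 * suc e + 1) * d       ≡⟨ solve (e ∷ d ∷ []) ⟩
  3 * d * suc e + d         <⟨ +-monoʳ-< (3 * d * suc e) small ⟩
  3 * d * suc e + c * suc e ≡⟨ solve (e ∷ d ∷ c ∷ []) ⟩
  (3 * d + c) * suc e       ∎
  where open ≤-Reasoning

≤*⇒*<*suc : ∀ {n c K} s → n ≤ c * K → 0 < c → n * s < c * suc (K * s)
≤*⇒*<*suc {n} {c} {K} s n≤cK c>0 = begin-strict
  n * s           ≤⟨ *-monoˡ-≤ s n≤cK ⟩
  c * K * s       <⟨ m<m+n (c * K * s) c>0 ⟩
  c * K * s + c   ≡⟨ solve (c ∷ K ∷ s ∷ []) ⟩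
  c * suc (K * s) ∎
  where open ≤-Reasoning

three+1/[1+e]<ratio+ratio : ∀ {m n r s c} e → 0 < n → 0 < s →
  m * s + r * n ≡ 3 * (n * s) + c → n * s < c * suc e →
  three +ᵘ mkℚᵘ (+ 1) e ℚᵘ.< ratio m n +ᵘ ratio r s
three+1/[1+e]<ratio+ratio {m} {suc n} {r} {suc s} e (s≤s z≤n) (s≤s z≤n) excess small =
  *<* (subst (ℤ._<_ _) (sym numerator-as-ℕ)
        (+<+ (subst (λ z → (3 * suc e + 1) * (suc n * suc s) < (m * suc s + r * suc n) * z)
                    (sym (*-identityˡ (suc e))) (excess-cross-multiplied e excess small))))
  where
  numerator-as-ℕ : (+ m ℤ.* + suc s ℤ.+ + r ℤ.* + suc n) ℤ.* + (1 * suc e)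
                 ≡ + ((m * suc s + r * suc n) * (1 * suc e))
  numerator-as-ℕ rewrite sym (pos-* m (suc s)) | sym (pos-* r (suc n)) =
    sym (pos-* (m * suc s + r * suc n) (1 * suc e))

cutApprox-digits : ∀ ω j k {front back} → frontDigits ω j k ≡ front → backDigits ω j ≡ back →
  cutApprox ω j k ≡ ratio (proj₁ (cfPair front)) (proj₂ (cfPair front))
                 +ᵘ ratio (proj₂ (cfPair back)) (proj₁ (cfPair back))
cutApprox-digits ω j k refl refl = refl

FrontReads : (ℕ → Letter) → ℕ → List Letter → Set
FrontReads ω j ys = ∀ k → length ys ≤ k → ∃₂ λ l L → frontDigits ω j k ≡ map val (ys ++ l ∷ L)

badCut-of-window : ∀ ω j w →
  backDigits ω j ≡ map val (two ∷ expand w) → FrontReads ω j (two ∷ one ∷ one ∷ expand w) → BadCut ω j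
badCut-of-window ω j w back front =
  mkℚᵘ (+ 1) e , *<* (+<+ (s≤s z≤n)) , length (two ∷ one ∷ one ∷ expand w) ,
  λ k N≤k → excess (proj₂ (proj₂ (front k N≤k)))
  where
  window : List ℕ
  window = map val (two ∷ one ∷ one ∷ expand w)
  s K e : ℕ
  s = proj₁ (cfPair (map val (two ∷ expand w)))
  -- the front denominator with the unread tail replaced by the larger value 3
  K = proj₂ (cfPair (window ++ 3 ∷ []))
  e = K * s
  excess : ∀ {k l L} → frontDigits ω j k ≡ map val (two ∷ one ∷ one ∷ expand w ++ l ∷ L) →
           three +ᵘ mkℚᵘ (+ 1) e ℚᵘ.< cutApprox ω j k
  excess {k} {l} {L} eq = subst (three +ᵘ mkℚᵘ (+ 1) e ℚᵘ.<_) (sym (cutApprox-digits ω j k eq back))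
    (three+1/[1+e]<ratio+ratio e d>0 s>0 (cut-identity cross-w) (≤*⇒*<*suc s d≤rK (proj₁ tail-bounds)))
    where
    r d : ℕ
    r = proj₁ (cfPair (map val L))
    d = proj₂ (cfPair (map val (two ∷ one ∷ one ∷ expand w ++ l ∷ L)))
    tail-bounds : 0 < r × Dominated r (cfPair (map val (l ∷ L))) (cfPair (3 ∷ []))
    tail-bounds = cfPair-letters-≤3 l L
    cross-w : Cross r (cfPair (map val (expand w))) (cfPair (map val (expand w ++ l ∷ L)))
    cross-w = cfPair-expand-Cross w (l ∷ L)
    d>0 : 0 < d
    d>0 = proj₁ (cfPair-letters (one ∷ one ∷ expand w ++ l ∷ L))
    s>0 : 0 < s
    s>0 = proj₁ (cfPair-letters (two ∷ expand w))
    d≤rK : d ≤ r * K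
    d≤rK = subst (λ ds → proj₂ (cfPair ds) ≤ r * K)
                 (sym (map-++ val (two ∷ one ∷ one ∷ expand w) (l ∷ L)))
             (Dominated.proj₂-≤ (cfPair-++-Dominated window (proj₂ tail-bounds)))

Palindrome : List AB → Set
Palindrome w = reverse w ≡ w

enclose : List AB → List AB
enclose w = a ∷ w ++ b ∷ []

expand-++ : ∀ x y → expand (x ++ y) ≡ expand x ++ expand y
expand-++ []      y = refl
expand-++ (a ∷ x) y = cong (λ z → two ∷ two ∷ z) (expand-++ x y)
expand-++ (b ∷ x) y = cong (λ z → one ∷ one ∷ z) (expand-++ x y)

length-expand : ∀ x → length (expand x) ≡ length x + length x
length-expand []      = refl
length-expand (a ∷ x) = cong suc (trans (cong suc (length-expand x)) (sym (+-suc _ _)))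
length-expand (b ∷ x) = cong suc (trans (cong suc (length-expand x)) (sym (+-suc _ _)))

expand-reverse : ∀ x → expand (reverse x) ≡ reverse (expand x)
expand-reverse []      = refl
expand-reverse (c ∷ x) = begin
  expand (reverse (c ∷ x))                  ≡⟨ cong expand (unfold-reverse c x) ⟩
  expand (reverse x ++ c ∷ [])              ≡⟨ expand-++ (reverse x) (c ∷ []) ⟩
  expand (reverse x) ++ expand (c ∷ [])     ≡⟨ cong₂ _++_ (expand-reverse x) (letter-palindrome c) ⟩
  reverse (expand x) ++ reverse (expandLetter c) ≡⟨ sym (reverse-++ (expandLetter c) (expand x)) ⟩
  reverse (expand (c ∷ x))                  ∎
  where
  open ≡-Reasoning
  letter-palindrome : ∀ c → expand (c ∷ []) ≡ reverse (expandLetter c)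
  letter-palindrome a = refl
  letter-palindrome b = refl

length-enclose : ∀ q → length (enclose q) ≡ suc (length (a ∷ q))
length-enclose q = cong suc (trans (length-++ q) (+-comm (length q) 1))

length-expand-enclose : ∀ q → length (expand (enclose q)) ≡ length (expand (a ∷ q)) + 2
length-expand-enclose q =
  trans (cong length (expand-++ (a ∷ q) (b ∷ []))) (length-++ (expand (a ∷ q)))

length-expand-mono : ∀ {x y} → length x ≤ length y → length (expand x) ≤ length (expand y)
length-expand-mono {x} {y} x≤y rewrite length-expand x | length-expand y = +-mono-≤ x≤y x≤y

IsPrefix-++⁻ : ∀ xs {ys ω} → IsPrefix (xs ++ ys) ω →
  IsPrefix xs ω × IsPrefix ys (λ t → ω (length xs + t))
IsPrefix-++⁻ []       h         = _ , h
IsPrefix-++⁻ (x ∷ xs) (x≡ , h) = (x≡ , proj₁ (IsPrefix-++⁻ xs h)) , proj₂ (IsPrefix-++⁻ xs h)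

IsPrefix⇒applyUpTo : ∀ xs {ω} → IsPrefix xs ω → ∀ m →
  applyUpTo ω (length xs + m) ≡ xs ++ applyUpTo (λ t → ω (length xs + t)) m
IsPrefix⇒applyUpTo []       _        m = refl
IsPrefix⇒applyUpTo (x ∷ xs) (x≡ , h) m = cong₂ _∷_ (sym x≡) (IsPrefix⇒applyUpTo xs h m)

backDigits-prefix : ∀ xs {ω} → IsPrefix xs ω → backDigits ω (length xs) ≡ map val (reverse xs)
backDigits-prefix xs {ω} h = begin
  reverse (map (λ t → val (ω t)) (upTo (length xs))) ≡⟨ cong reverse (map-upTo _ (length xs)) ⟩
  reverse (applyUpTo (λ t → val (ω t)) (length xs))  ≡⟨ cong reverse (sym (map-applyUpTo ω val (length xs))) ⟩
  reverse (map val (applyUpTo ω (length xs)))         ≡⟨ cong (reverse ∘ map val) read ⟩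
  reverse (map val xs)                                ≡⟨ sym (reverse-map val xs) ⟩
  map val (reverse xs)                                ∎
  where
  open ≡-Reasoning
  read : applyUpTo ω (length xs) ≡ xs
  read = begin
    applyUpTo ω (length xs)     ≡⟨ cong (applyUpTo ω) (sym (+-identityʳ (length xs))) ⟩
    applyUpTo ω (length xs + 0) ≡⟨ IsPrefix⇒applyUpTo xs h 0 ⟩
    xs ++ []                    ≡⟨ ++-identityʳ xs ⟩
    xs                          ∎

frontDigits-prefix : ∀ ys {ω j} → IsPrefix ys (λ t → ω (j + t)) → FrontReads ω j ys
frontDigits-prefix ys {ω} {j} h k |ys|≤k = _ , _ , (begin
  map (λ t → val (ω (j + t))) (upTo (suc k))  ≡⟨ map-upTo _ (suc k) ⟩
  applyUpTo (val ∘ shifted) (suc k)            ≡⟨ sym (map-applyUpTo shifted val (suc k)) ⟩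
  map val (applyUpTo shifted (suc k))          ≡⟨ cong (map val ∘ applyUpTo shifted) (sym length-split) ⟩
  map val (applyUpTo shifted (length ys + suc m)) ≡⟨ cong (map val) (IsPrefix⇒applyUpTo ys h (suc m)) ⟩
  map val (ys ++ applyUpTo (λ t → shifted (length ys + t)) (suc m)) ∎)
  where
  open ≡-Reasoning
  shifted : ℕ → Letter
  shifted t = ω (j + t)
  m = k ∸ length ys
  length-split : length ys + suc m ≡ suc k
  length-split = trans (+-suc (length ys) m) (cong suc (m+[n∸m]≡n |ys|≤k))

badCut-inside-aqabqa : ∀ ω q rest → Palindrome q →
  IsPrefix (expand (a ∷ q ++ a ∷ b ∷ q ++ a ∷ rest)) ω → BadCut ω (length (expand (a ∷ q)) + 1)
badCut-inside-aqabqa ω q rest q-pal h =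
  subst (BadCut ω) (length-++ (expand (a ∷ q)))
    (badCut-of-window ω (length before) (q ++ a ∷ []) back front)
  where
  open ≡-Reasoning
  before after : List Letter
  before = expand (a ∷ q) ++ two ∷ []
  after  = two ∷ one ∷ one ∷ expand (q ++ a ∷ [])
  split : expand (a ∷ q ++ a ∷ b ∷ q ++ a ∷ rest) ≡ before ++ after ++ expand rest
  split = begin
    expand ((a ∷ q) ++ a ∷ b ∷ q ++ a ∷ rest)
      ≡⟨ expand-++ (a ∷ q) _ ⟩
    expand (a ∷ q) ++ two ∷ two ∷ one ∷ one ∷ expand (q ++ a ∷ rest)
      ≡⟨ cong (λ w → expand (a ∷ q) ++ two ∷ two ∷ one ∷ one ∷ expand w) (sym (++-assoc q (a ∷ []) rest)) ⟩
    expand (a ∷ q) ++ two ∷ two ∷ one ∷ one ∷ expand ((q ++ a ∷ []) ++ rest)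
      ≡⟨ cong (λ w → expand (a ∷ q) ++ two ∷ two ∷ one ∷ one ∷ w) (expand-++ (q ++ a ∷ []) rest) ⟩
    expand (a ∷ q) ++ two ∷ after ++ expand rest
      ≡⟨ sym (++-assoc (expand (a ∷ q)) (two ∷ []) _) ⟩
    before ++ after ++ expand rest ∎
  split-prefix : IsPrefix before ω × IsPrefix (after ++ expand rest) (λ t → ω (length before + t))
  split-prefix = IsPrefix-++⁻ before {ω = ω} (subst (λ w → IsPrefix w ω) split h)
  reverse-before : reverse before ≡ two ∷ expand (q ++ a ∷ [])
  reverse-before = begin
    reverse (expand (a ∷ q) ++ two ∷ [])   ≡⟨ reverse-++ (expand (a ∷ q)) (two ∷ []) ⟩
    two ∷ reverse (expand (a ∷ q))          ≡⟨ cong (two ∷_) (sym (expand-reverse (a ∷ q))) ⟩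
    two ∷ expand (reverse (a ∷ q))          ≡⟨ cong (λ w → two ∷ expand w) (unfold-reverse a q) ⟩
    two ∷ expand (reverse q ++ a ∷ [])      ≡⟨ cong (λ w → two ∷ expand (w ++ a ∷ [])) q-pal ⟩
    two ∷ expand (q ++ a ∷ [])              ∎
  back : backDigits ω (length before) ≡ map val (two ∷ expand (q ++ a ∷ []))
  back = trans (backDigits-prefix before (proj₁ split-prefix)) (cong (map val) reverse-before)
  front : FrontReads ω (length before) after
  front = frontDigits-prefix after {ω} {length before}
            (proj₁ (IsPrefix-++⁻ after {ω = λ t → ω (length before + t)} (proj₂ split-prefix)))

reverse-++-∷-∷ : ∀ {A : Set} (xs : List A) y z ws →
  reverse (xs ++ y ∷ z ∷ ws) ≡ reverse ws ++ z ∷ y ∷ reverse xs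
reverse-++-∷-∷ xs y z ws = begin
  reverse (xs ++ y ∷ z ∷ ws)                   ≡⟨ reverse-++ xs (y ∷ z ∷ ws) ⟩
  reverse ((y ∷ z ∷ []) ++ ws) ++ reverse xs   ≡⟨ cong (_++ reverse xs) (reverse-++ (y ∷ z ∷ []) ws) ⟩
  (reverse ws ++ z ∷ y ∷ []) ++ reverse xs     ≡⟨ ++-assoc (reverse ws) (z ∷ y ∷ []) (reverse xs) ⟩
  reverse ws ++ z ∷ y ∷ reverse xs             ∎
  where open ≡-Reasoning

record CentralPair (p q : List AB) : Set where
  field
    palindromeˡ : Palindrome p
    palindromeʳ : Palindrome q
    commute     : p ++ b ∷ a ∷ q ≡ q ++ a ∷ b ∷ p

module _ {q : List AB} where
  open ≡-Reasoning

  grow : List AB → List AB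
  grow x = x ++ b ∷ a ∷ q

  palindrome-grow : ∀ {x} → CentralPair x q → Palindrome (grow x)
  palindrome-grow {x} c = begin
    reverse (x ++ b ∷ a ∷ q)         ≡⟨ reverse-++-∷-∷ x b a q ⟩
    reverse q ++ a ∷ b ∷ reverse x   ≡⟨ cong₂ (λ u v → u ++ a ∷ b ∷ v) palindromeʳ palindromeˡ ⟩
    q ++ a ∷ b ∷ x                   ≡⟨ sym commute ⟩
    x ++ b ∷ a ∷ q                   ∎
    where open CentralPair c

  CentralPair-grow : ∀ {x} → CentralPair x q → CentralPair (grow x) q
  CentralPair-grow {x} c = record
    { palindromeˡ = palindrome-grow c
    ; palindromeʳ = palindromeʳ
    ; commute     = begin
        (x ++ b ∷ a ∷ q) ++ b ∷ a ∷ q ≡⟨ cong (_++ b ∷ a ∷ q) commute ⟩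
        (q ++ a ∷ b ∷ x) ++ b ∷ a ∷ q ≡⟨ ++-assoc q (a ∷ b ∷ x) (b ∷ a ∷ q) ⟩
        q ++ a ∷ b ∷ grow x           ∎
    }
    where open CentralPair c

  CentralPair-next : ∀ {x} → CentralPair x q → CentralPair x (grow x)
  CentralPair-next {x} c = record
    { palindromeˡ = palindromeˡ
    ; palindromeʳ = palindrome-grow c
    ; commute     = begin
        x ++ b ∷ a ∷ grow x           ≡⟨ cong (λ w → x ++ b ∷ a ∷ w) commute ⟩
        x ++ b ∷ a ∷ q ++ a ∷ b ∷ x   ≡⟨ sym (++-assoc x (b ∷ a ∷ q) (a ∷ b ∷ x)) ⟩
        grow x ++ a ∷ b ∷ x           ∎
    }
    where open CentralPair c

  grow²-commute : ∀ {x} → CentralPair x q → grow (grow x) ≡ q ++ a ∷ b ∷ q ++ a ∷ b ∷ x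
  grow²-commute c =
    trans (CentralPair.commute (CentralPair-grow c)) (cong (λ w → q ++ a ∷ b ∷ w) (CentralPair.commute c))

  enclose-grow : ∀ x → enclose x ++ enclose q ≡ enclose (grow x)
  enclose-grow x = cong (a ∷_) (begin
    (x ++ b ∷ []) ++ a ∷ q ++ b ∷ [] ≡⟨ ++-assoc x (b ∷ []) _ ⟩
    x ++ b ∷ a ∷ q ++ b ∷ []         ≡⟨ sym (++-assoc x (b ∷ a ∷ q) (b ∷ [])) ⟩
    grow x ++ b ∷ []                 ∎)

  enclose-absorb : ∀ x ys → enclose x ++ enclose q ++ ys ≡ enclose (grow x) ++ ys
  enclose-absorb x ys = trans (sym (++-assoc (enclose x) (enclose q) ys)) (cong (_++ ys) (enclose-grow x))

  enclose-grow² : ∀ x → enclose x ++ enclose q ++ enclose q ≡ enclose (grow (grow x))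
  enclose-grow² x = trans (enclose-absorb x _) (enclose-grow (grow x))

  enclose-grow³ : ∀ x → enclose x ++ enclose q ++ enclose q ++ enclose q ≡ enclose (grow (grow (grow x)))
  enclose-grow³ x = trans (enclose-absorb x _) (enclose-grow² (grow x))

  enclose-grow⁴ : ∀ x → enclose x ++ enclose q ++ enclose q ++ enclose q ++ enclose q
                       ≡ enclose (grow (grow (grow (grow x))))
  enclose-grow⁴ x = trans (enclose-absorb x _) (enclose-grow³ (grow x))

record StandardPair (αβ : List AB × List AB) : Set where
  field
    {p q}   : List AB
    central : CentralPair p q
    α≡      : proj₁ αβ ≡ enclose p
    β≡      : proj₂ αβ ≡ enclose q

applySubst-StandardPair : ∀ s {αβ} → StandardPair αβ → StandardPair (applySubst s αβ)
applySubst-StandardPair U record { central = c ; α≡ = refl ; β≡ = refl } = record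
  { central = CentralPair-next (CentralPair-grow (CentralPair-grow c))
  ; α≡ = enclose-grow² _ ; β≡ = enclose-grow³ _ }
applySubst-StandardPair V record { central = c ; α≡ = refl ; β≡ = refl } = record
  { central = CentralPair-next (CentralPair-grow (CentralPair-grow (CentralPair-grow c)))
  ; α≡ = enclose-grow³ _ ; β≡ = enclose-grow⁴ _ }

αβ-StandardPair : ∀ R n → StandardPair (αβ R (suc n))
αβ-StandardPair R zero with R 0
... | U = record { central = central-aba-ababa ; α≡ = refl ; β≡ = refl }
  where
  central-aba-ababa : CentralPair (a ∷ b ∷ a ∷ []) (a ∷ b ∷ a ∷ b ∷ a ∷ [])
  central-aba-ababa = record { palindromeˡ = refl ; palindromeʳ = refl ; commute = refl }
... | V = record { central = central-ababa-abababa ; α≡ = refl ; β≡ = refl }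
  where
  central-ababa-abababa : CentralPair (a ∷ b ∷ a ∷ b ∷ a ∷ []) (a ∷ b ∷ a ∷ b ∷ a ∷ b ∷ a ∷ [])
  central-ababa-abababa = record { palindromeˡ = refl ; palindromeʳ = refl ; commute = refl }
αβ-StandardPair R (suc n) = applySubst-StandardPair (R (suc n)) (αβ-StandardPair R n)

αββ-shape : ∀ R n → ∃₂ λ q rest → Palindrome q × β R n ≡ enclose q ×
  α R n ++ β R n ++ β R n ≡ a ∷ q ++ a ∷ b ∷ q ++ a ∷ rest
αββ-shape R zero    = [] , b ∷ [] , refl , refl , refl
αββ-shape R (suc n) = q , b ∷ p ++ b ∷ [] , palindromeʳ , β≡ , (begin
  α R (suc n) ++ β R (suc n) ++ β R (suc n) ≡⟨ cong₂ (λ x y → x ++ y ++ y) α≡ β≡ ⟩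
  enclose p ++ enclose q ++ enclose q       ≡⟨ enclose-grow² p ⟩
  enclose (grow (grow p))                   ≡⟨ cong enclose (grow²-commute central) ⟩
  enclose (q ++ a ∷ b ∷ q ++ a ∷ b ∷ p)     ≡⟨ cong (a ∷_) (++-assoc q _ (b ∷ [])) ⟩
  a ∷ q ++ a ∷ b ∷ (q ++ a ∷ b ∷ p) ++ b ∷ [] ≡⟨ cong (λ w → a ∷ q ++ a ∷ b ∷ w) (++-assoc q _ (b ∷ [])) ⟩
  a ∷ q ++ a ∷ b ∷ q ++ a ∷ b ∷ p ++ b ∷ [] ∎)
  where
  open ≡-Reasoning
  open StandardPair (αβ-StandardPair R n)
  open CentralPair central

applySubst-β≡α++β : ∀ s αβ → proj₂ (applySubst s αβ) ≡ proj₁ (applySubst s αβ) ++ proj₂ αβ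
applySubst-β≡α++β U (x , y) = snoc-last x y
  where
  snoc-last : ∀ x y → x ++ y ++ y ++ y ≡ (x ++ y ++ y) ++ y
  snoc-last x y = trans (cong (x ++_) (sym (++-assoc y y y))) (sym (++-assoc x (y ++ y) y))
applySubst-β≡α++β V (x , y) = begin
  x ++ y ++ y ++ y ++ y         ≡⟨ sym (++-assoc x y _) ⟩
  (x ++ y) ++ y ++ y ++ y       ≡⟨ applySubst-β≡α++β U (x ++ y , y) ⟩
  ((x ++ y) ++ y ++ y) ++ y     ≡⟨ cong (_++ y) (++-assoc x y (y ++ y)) ⟩
  (x ++ y ++ y ++ y) ++ y       ∎
  where open ≡-Reasoning

length-α<β : ∀ R n → length (α R n) < length (β R n)
length-α<β R zero    = s≤s (s≤s z≤n)
length-α<β R (suc n) = begin-strict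
  length (α R (suc n))                      <⟨ m<m+n _ (≤-trans (s≤s z≤n) (length-α<β R n)) ⟩
  length (α R (suc n)) + length (β R n)     ≡⟨ sym (length-++ (α R (suc n))) ⟩
  length (α R (suc n) ++ β R n)             ≡⟨ cong length (sym (applySubst-β≡α++β (R n) (αβ R n))) ⟩
  length (β R (suc n))                      ∎
  where open ≤-Reasoning

lemma3p2 : (R : ℕ → Subst) (ω : ℕ → Letter)
    → ((m : ℕ) → IsPrefix (expand (α R m ++ β R m ++ β R m)) ω)
    → (n : ℕ)
    → ∃[ j ] ((length (expand (α R n)) + 1 ≤ j)
              × (j + 1 ≤ length (expand (α R n)) + length (expand (β R n)))
              × BadCut ω j)
lemma3p2 R ω prefixes n with αββ-shape R n
... | q , rest , q-pal , β≡ , αββ≡ =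
  length (expand (a ∷ q)) + 1 , after-α , inside-β ,
  badCut-inside-aqabqa ω q rest q-pal (subst (λ w → IsPrefix (expand w) ω) αββ≡ (prefixes n))
  where
  open ≤-Reasoning
  α-short : length (α R n) ≤ length (a ∷ q)
  α-short = ≤-pred (subst (length (α R n) <_) (trans (cong length β≡) (length-enclose q)) (length-α<β R n))
  after-α : length (expand (α R n)) + 1 ≤ length (expand (a ∷ q)) + 1
  after-α = +-monoˡ-≤ 1 (length-expand-mono {α R n} {a ∷ q} α-short)
  inside-β : length (expand (a ∷ q)) + 1 + 1 ≤ length (expand (α R n)) + length (expand (β R n))
  inside-β = begin
    length (expand (a ∷ q)) + 1 + 1 ≡⟨ +-assoc (length (expand (a ∷ q))) 1 1 ⟩
    length (expand (a ∷ q)) + 2     ≡⟨ sym (length-expand-enclose q) ⟩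
    length (expand (enclose q))     ≡⟨ cong (length ∘ expand) (sym β≡) ⟩
    length (expand (β R n))         ≤⟨ m≤n+m _ _ ⟩
    length (expand (α R n)) + length (expand (β R n)) ∎
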